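{- Let $G$ be an $n$-vertex graph with $n\ge 5$. If $G$ contains (as a subgraph) the square of an $n$-vertex tree, then $G$ is canceling. If $G$ contains the square of a Hamiltonian cycle (i.e. the square of an $n$-vertex cycle on $V(G)$), then $G$ is $2$-canceling.
   Context: All graphs are finite and simple. The square $H^2$ of a graph $H$ has vertex set $V(H)$, with $uv$ an edge iff $1\le d_H(u,v)\le 2$. A signing of $G$ is a function $\sigma:E(G)\to\{\pm1\}$. For a path $P$, $\sigma(P)=\sum_{e\in P}\sigma(e)$. The signed distance is $d_\sigma(u,v)=\min_P|\sigma(P)|$ over all $uv$-paths $P$ in $G$ (with $d_\sigma(u,v)=\infty$ if no such path exists, and $d_\sigma(u,u)=0$). The signed Wiener index is $W_\sigma(G)=\frac12\sum_{u,v\in V(G)}d_\sigma(u,v)$. For a subgraph or induced subgraph $G-S$ ($S\subseteq V(G)$, deleting the vertices of $S$), $\sigma$ is restricted to its edges and distances are computed within $G-S$. A signing $\sigma$ is $k$-canceling if $W_\sigma(G-S)=0$ for every $S\subseteq V(G)$ with $|S|<k$; $G$ is $k$-canceling if it has a $k$-canceling signing, and "canceling" means $1$-canceling (i.e. some signing has $W_\sigma(G)=0$). -}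

module Defs where

open import Data.Bool using (Bool; true; false; _∧_; not; if_then_else_)
open import Data.Nat as ℕ using (ℕ; zero; suc; _≤_; _<_; _⊓_; _/_)
import Data.Nat as N
open import Data.Integer as ℤ using (ℤ)
open import Data.Fin using (Fin; toℕ; _≟_)
open import Data.Fin.Subset using (Subset; ∣_∣)
open import Data.Vec using (lookup)
open import Data.List using (List; []; _∷_; map; concatMap; foldr; allFin; filterᵇ)
open import Data.Bool.ListAction using (any)
open import Data.Maybe using (Maybe; just; nothing)
open import Data.Sign using (Sign)
open import Data.Product using (Σ; ∃; _×_; _,_)
open import Data.Sum using (_⊎_)
open import Relation.Nullary using (¬_; ⌊_⌋)
open import Relation.Binary.PropositionalEquality using (_≡_; _≢_)
open import Function.Definitions using (Injective)

record Graph (n : ℕ) : Set where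
  field
    adj    : Fin n → Fin n → Bool
    sym    : ∀ u v → adj u v ≡ adj v u
    irrefl : ∀ u → adj u u ≡ false
open Graph public

Adj : ∀ {n} → Graph n → Fin n → Fin n → Set
Adj H u v = adj H u v ≡ true

data Walk {n : ℕ} (H : Graph n) : Fin n → Fin n → Set where
  stop : ∀ u → Walk H u u
  step : ∀ {u w v} → Adj H u w → Walk H w v → Walk H u v

Connected : ∀ {n} → Graph n → Set
Connected H = ∀ u v → Walk H u v

-- adjacency of the k-cycle C_k on vertex set Fin k (i ~ i+1 mod k)
CycAdj : (k : ℕ) → Fin k → Fin k → Set
CycAdj k i j =
  (suc (toℕ i) ≡ toℕ j) ⊎ (suc (toℕ j) ≡ toℕ i)
  ⊎ ((toℕ i ≡ 0 × suc (toℕ j) ≡ k) ⊎ (toℕ j ≡ 0 × suc (toℕ i) ≡ k))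

HasCycle : ∀ {n} → Graph n → Set
HasCycle {n} H = Σ ℕ λ k → (3 ≤ k) × Σ (Fin k → Fin n) λ f →
  Injective _≡_ _≡_ f × (∀ i j → CycAdj k i j → Adj H (f i) (f j))

IsTree : ∀ {n} → Graph n → Set
IsTree H = Connected H × ¬ HasCycle H

-- square of a graph given by an adjacency relation R:
-- u ~ v iff 1 ≤ d_R(u,v) ≤ 2
SqRel : ∀ {n} → (Fin n → Fin n → Set) → Fin n → Fin n → Set
SqRel {n} R u v = u ≢ v × (R u v ⊎ Σ (Fin n) λ w → R u w × R w v)

-- Signings: a sign for each (unordered) pair; only values on edges matter

record Signing {n : ℕ} (G : Graph n) : Set where
  field
    σ    : Fin n → Fin n → Sign
    σsym : ∀ u v → σ u v ≡ σ v u
open Signing public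

sgn : Sign → ℤ
sgn Sign.+ = ℤ.+ 1
sgn Sign.- = ℤ.- (ℤ.+ 1)

-- σ(P) for a path given by its vertex sequence
pathSum : ∀ {n} → (Fin n → Fin n → Sign) → List (Fin n) → ℤ
pathSum s []           = ℤ.+ 0
pathSum s (x ∷ [])     = ℤ.+ 0
pathSum s (x ∷ y ∷ ps) = sgn (s x y) ℤ.+ pathSum s (y ∷ ps)

_∈ᵇ_ : ∀ {n} → Fin n → List (Fin n) → Bool
y ∈ᵇ xs = any (λ z → ⌊ z ≟ y ⌋) xs

-- all simple paths (vertex sequences) of G - S starting at x, having
-- already visited `vis`; fuel bounds the number of further steps
pathsFrom : ∀ {n} → Graph n → Subset n → ℕ → List (Fin n) → Fin n → List (List (Fin n))
pathsFrom G S zero    vis x = (x ∷ []) ∷ []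
pathsFrom {n} G S (suc k) vis x =
  (x ∷ []) ∷ concatMap
    (λ y → if adj G x y ∧ not (lookup S y) ∧ not (y ∈ᵇ (x ∷ vis))
           then map (x ∷_) (pathsFrom G S k (x ∷ vis) y)
           else [])
    (allFin n)

last? : ∀ {n} → List (Fin n) → Maybe (Fin n)
last? []           = nothing
last? (x ∷ [])     = just x
last? (x ∷ y ∷ xs) = last? (y ∷ xs)

endsAt : ∀ {n} → Fin n → List (Fin n) → Bool
endsAt v p with last? p
... | just w  = ⌊ w ≟ v ⌋
... | nothing = false

-- ℕ ∪ {∞}, with nothing = ∞
ℕ∞ : Set
ℕ∞ = Maybe ℕ

min∞ : ℕ∞ → ℕ∞ → ℕ∞
min∞ nothing  b        = b
min∞ (just a) nothing  = just a
min∞ (just a) (just b) = just (a ⊓ b)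

_+∞_ : ℕ∞ → ℕ∞ → ℕ∞
just a +∞ just b = just (a N.+ b)
_      +∞ _      = nothing

-- signed distance d_σ(u,v) in G - S (u, v assumed not in S):
-- minimum of |σ(P)| over all uv-paths P in G - S, ∞ if there is none
dσ : ∀ {n} (G : Graph n) → Signing G → Subset n → Fin n → Fin n → ℕ∞
dσ {n} G s S u v =
  foldr (λ p m → min∞ (just (ℤ.∣ pathSum (σ s) p ∣)) m) nothing
        (filterᵇ (λ p → endsAt v p) (pathsFrom G S n [] u))

-- signed Wiener index of G - S: (1/2) Σ_{u,v ∈ V(G) ∖ S} d_σ(u,v)
Wσ : ∀ {n} (G : Graph n) → Signing G → Subset n → ℕ∞
Wσ {n} G s S with
  foldr _+∞_ (just 0)
    (concatMap (λ u → concatMap (λ v →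
        if lookup S u then [] else if lookup S v then [] else dσ G s S u v ∷ [])
      (allFin n)) (allFin n))
... | just t  = just (t / 2)
... | nothing = nothing

KCanceling : ∀ {n} → ℕ → Graph n → Set
KCanceling {n} k G = Σ (Signing G) λ s → ∀ (S : Subset n) → ∣ S ∣ < k → Wσ G s S ≡ just 0

Canceling : ∀ {n} → Graph n → Set
Canceling G = KCanceling 1 G

ContainsSqTree : ∀ {n} → Graph n → Set
ContainsSqTree {n} G = Σ (Graph n) λ T → IsTree T × (∀ u v → SqRel (Adj T) u v → Adj G u v)

ContainsSqHamCycle : ∀ {n} → Graph n → Set
ContainsSqHamCycle {n} G = Σ (Fin n → Fin n) λ f →
  Injective _≡_ _≡_ f × (∀ i j → SqRel (CycAdj n) i j → Adj G (f i) (f j))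

-- W_σ(G − S) vanishes as soon as any two vertices of G − S are joined in G − S by a path whose signs sum to zero,
-- so it suffices to exhibit such zero paths. They are found inside small signed patterns on the indices 0, 1, …
-- that embed into G. The basic pattern is the ladder, the square of a path signed + on path edges and − on chords:
-- it has zero routes spanning 3 and 4 steps, hence by concatenation every span ≥ 6, and on at least seven vertices
-- short detours also handle the spans 1, 2 and 5.
--
-- For the square of a tree T, sign the edges of T positively and all other pairs negatively. The tree path between
-- two vertices is a ladder; when it has 1, 2 or 5 edges, one or two further leaves of T supply the detour. The only
-- exception, T a path on six vertices with n = 6, is repaired by switching the signing at an end vertex.
--
-- For the square of a Hamiltonian cycle, sign cycle edges positively and chords negatively. Deleting a vertex w
-- leaves a ladder on n − 1 ≥ 7 vertices when n ≥ 8; when nothing is deleted, avoid any third vertex. For n = 5, 6, 7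
-- the finitely many cases are settled by a search whose answers are checked, with a special signing for n = 7.

module Submission where

open import Defs hiding (sym)
open import Data.Bool as Bool using (Bool; true; false; _∧_; _∨_; not; if_then_else_; T)
import Data.Bool.Properties as Bool
open import Data.Bool.ListAction using (all; any)
open import Data.Nat as ℕ using (ℕ; zero; suc; _+_; _∸_; _≤_; _<_; _≡ᵇ_; z≤n; s≤s)
import Data.Nat.Properties as ℕ
open import Data.Nat.DivMod using (_%_; _mod_; m<n⇒m%n≡m; n%n≡0)
open import Data.Integer as ℤ using (ℤ; 0ℤ)
import Data.Integer.Properties as ℤ
open import Data.Fin as Fin using (Fin; toℕ)
import Data.Fin.Properties as Fin
open import Data.Fin.Subset using (Subset; ∣_∣)
open import Data.Vec using (lookup; []; _∷_)
open import Data.List as List using (List; []; _∷_; _++_; _∷ʳ_; length; reverse; concatMap; foldr; allFin; upTo)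
import Data.List.Properties as List
open import Data.List.Relation.Unary.All as All using (All; []; _∷_)
import Data.List.Relation.Unary.All.Properties as All
open import Data.List.Relation.Unary.Any as Any using (Any; here; there)
import Data.List.Relation.Unary.Any.Properties as Any
open import Data.List.Relation.Unary.Unique.Propositional using (Unique; []; _∷_)
import Data.List.Relation.Unary.Unique.Propositional.Properties as Unique
open import Data.List.Relation.Unary.Unique.DecPropositional ℕ._≟_ using (unique?)
open import Data.List.Membership.Propositional using (_∈_; _∉_)
open import Data.List.Membership.Propositional.Properties
  using (∈-concatMap⁺; ∈-map⁺; ∈-map⁻; ∈-allFin; ∈-filter⁺; ∈-lookup; ∈-upTo⁺)
import Data.List.Membership.DecPropositional as DecMembership
open import Data.Maybe as Maybe using (Maybe; just; nothing; is-just; to-witness-T; from-just; _>>=_; _<∣>_)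
open import Data.Sign as Sign using (Sign)
open import Data.Product using (Σ; _×_; _,_; proj₁; proj₂)
open import Data.Sum using (_⊎_; inj₁; inj₂)
open import Data.Unit using (⊤; tt)
open import Data.Empty using (⊥; ⊥-elim)
open import Function using (_∘_; id)
open import Function.Bundles using (Equivalence; mk⇔)
open import Relation.Nullary using (¬_; Dec; does; yes; no; ⌊_⌋)
open import Relation.Nullary.Decidable using (T?; toWitness; _×-dec_; _⊎-dec_; ¬?; does-⇔; dec-true; dec-false)
open import Relation.Binary.Definitions using (tri<; tri≈; tri>)
open import Relation.Binary.PropositionalEquality
  using (_≡_; _≢_; refl; sym; trans; cong; cong₂; subst; subst₂; module ≡-Reasoning)
open ≡-Reasoning
open Equivalence using (to; from)

private variable
  n : ℕ

-- Zero paths and the signed Wiener index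

Adj-sym : ∀ {G : Graph n} {u v} → Adj G u v → Adj G v u
Adj-sym {G = G} {u} {v} uv = trans (Graph.sym G v u) uv

module _ (G : Graph n) (Allowed : Fin n → Set) where

  data Path : Fin n → Fin n → List (Fin n) → Set where
    end : ∀ {u} → Allowed u → Path u u (u ∷ [])
    step : ∀ {u w v p} → Allowed u → Adj G u w → Path w v (w ∷ p) → Path u v (u ∷ w ∷ p)

  ZeroPath : (Fin n → Fin n → Sign) → Fin n → Fin n → Set
  ZeroPath σ u v = Σ (List (Fin n)) λ p → Path u v p × Unique p × pathSum σ p ≡ 0ℤ

module _ {G : Graph n} {P Q : Fin n → Set} (P⊆Q : ∀ {x} → P x → Q x) where

  Path-weaken : ∀ {u v p} → Path G P u v p → Path G Q u v p
  Path-weaken (end pu)      = end (P⊆Q pu)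
  Path-weaken (step pu a π) = step (P⊆Q pu) a (Path-weaken π)

  ZeroPath-weaken : ∀ {σ u v} → ZeroPath G P σ u v → ZeroPath G Q σ u v
  ZeroPath-weaken (p , π , p! , p₀) = p , Path-weaken π , p! , p₀

module _ {G : Graph n} {Allowed : Fin n → Set} where

  Path-allowed : ∀ {u v p} → Path G Allowed u v p → All Allowed p
  Path-allowed (end a)      = a ∷ []
  Path-allowed (step a _ π) = a ∷ Path-allowed π

  Path-cons : ∀ {u w v p} → Allowed u → Adj G u w → Path G Allowed w v p → Path G Allowed u v (u ∷ p)
  Path-cons a uw π@(end _)      = step a uw π
  Path-cons a uw π@(step _ _ _) = step a uw π

  Path-last? : ∀ {u v p} → Path G Allowed u v p → last? p ≡ just v
  Path-last? (end _)                   = refl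
  Path-last? (step _ _ (end _))        = refl
  Path-last? (step _ _ π@(step _ _ _)) = Path-last? π

  ZeroPath-refl : ∀ {σ u} → Allowed u → ZeroPath G Allowed σ u u
  ZeroPath-refl a = _ , end a , [] ∷ [] , refl

  Path-snoc : ∀ {u v w p} → Path G Allowed u v p → Adj G v w → Allowed w → Path G Allowed u w (p ∷ʳ w)
  Path-snoc (end a)       vw aw = step a vw (end aw)
  Path-snoc (step a uw π) vw aw = step a uw (Path-snoc π vw aw)

  pathSum-snoc : ∀ σ {u v w p} → Path G Allowed u v p → pathSum σ (p ∷ʳ w) ≡ pathSum σ p ℤ.+ sgn (σ v w)
  pathSum-snoc σ {u} {w = w} (end _) = trans (ℤ.+-identityʳ (sgn (σ u w))) (sym (ℤ.+-identityˡ (sgn (σ u w))))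
  pathSum-snoc σ {u} {v} {w} (step {w = x} {p = p} _ _ π) = begin
    sgn (σ u x) ℤ.+ pathSum σ ((x ∷ p) ∷ʳ w)                 ≡⟨ cong (λ t → sgn (σ u x) ℤ.+ t) (pathSum-snoc σ π) ⟩
    sgn (σ u x) ℤ.+ (pathSum σ (x ∷ p) ℤ.+ sgn (σ v w))      ≡⟨ ℤ.+-assoc (sgn (σ u x)) _ _ ⟨
    sgn (σ u x) ℤ.+ pathSum σ (x ∷ p) ℤ.+ sgn (σ v w)        ∎

  Path-reverse : ∀ {u v p} → Path G Allowed u v p → Path G Allowed v u (reverse p)
  Path-reverse (end a) = end a
  Path-reverse {u} (step {w = w} {p = p} a uw π) =
    subst (Path G Allowed _ u) (sym (List.unfold-reverse u (w ∷ p)))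
      (Path-snoc (Path-reverse π) (Adj-sym {G = G} uw) a)

  pathSum-reverse : (s : Signing G) → ∀ {u v p} → Path G Allowed u v p → pathSum (σ s) (reverse p) ≡ pathSum (σ s) p
  pathSum-reverse s (end _) = refl
  pathSum-reverse s {u} (step {w = w} {p = p} a uw π) = begin
    pathSum (σ s) (reverse (u ∷ w ∷ p))                    ≡⟨ cong (pathSum (σ s)) (List.unfold-reverse u (w ∷ p)) ⟩
    pathSum (σ s) (reverse (w ∷ p) ∷ʳ u)                   ≡⟨ pathSum-snoc (σ s) (Path-reverse π) ⟩
    pathSum (σ s) (reverse (w ∷ p)) ℤ.+ sgn (σ s w u)      ≡⟨ cong₂ ℤ._+_ (pathSum-reverse s π) (cong sgn (σsym s w u)) ⟩
    pathSum (σ s) (w ∷ p) ℤ.+ sgn (σ s u w)                ≡⟨ ℤ.+-comm _ (sgn (σ s u w)) ⟩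
    pathSum (σ s) (u ∷ w ∷ p)                              ∎

Unique-reverse : ∀ {A : Set} {xs : List A} → Unique xs → Unique (reverse xs)
Unique-reverse [] = []
Unique-reverse {xs = x ∷ xs} (x∉xs ∷ xs!) = subst Unique (sym (List.unfold-reverse x xs))
  (Unique.++⁺ (Unique-reverse xs!) ([] ∷ [])
    λ { (x∈rev , here refl) → All.lookup x∉xs (Any.reverse⁻ x∈rev) refl })

ZeroPath-sym : ∀ {G : Graph n} {Allowed} (s : Signing G) {u v} →
               ZeroPath G Allowed (σ s) u v → ZeroPath G Allowed (σ s) v u
ZeroPath-sym s (p , π , p! , p₀) =
  reverse p , Path-reverse π , Unique-reverse p! , trans (pathSum-reverse s π) p₀

lookup-injective : ∀ {A : Set} {xs : List A} → Unique xs → ∀ {i j} → List.lookup xs i ≡ List.lookup xs j → i ≡ j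
lookup-injective {xs = _ ∷ _} _            {Fin.zero}  {Fin.zero}  _ = refl
lookup-injective {xs = _ ∷ _} (x∉xs ∷ _)   {Fin.zero}  {Fin.suc j} e = ⊥-elim (All.lookup x∉xs (∈-lookup j) e)
lookup-injective {xs = _ ∷ _} (x∉xs ∷ _)   {Fin.suc i} {Fin.zero}  e = ⊥-elim (All.lookup x∉xs (∈-lookup i) (sym e))
lookup-injective {xs = _ ∷ _} (_ ∷ xs!)    {Fin.suc i} {Fin.suc j} e = cong Fin.suc (lookup-injective xs! e)

Unique⇒length≤ : ∀ {xs : List (Fin n)} → Unique xs → length xs ≤ n
Unique⇒length≤ xs! = Fin.injective⇒≤ (lookup-injective xs!)

module _ (G : Graph n) (S : Subset n) where

  Outside : Fin n → Set
  Outside x = lookup S x ≡ false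

  private
    ∈ᵇ-false : ∀ {y} {xs : List (Fin n)} → y ∉ xs → (y ∈ᵇ xs) ≡ false
    ∈ᵇ-false {y} {xs} y∉xs with y ∈ᵇ xs in eq
    ... | false = refl
    ... | true  = ⊥-elim (y∉xs (Any.map (sym ∘ toWitness) (Any.any⁻ _ xs (subst T (sym eq) _))))

  pathsFrom-complete : ∀ fuel vis {u v p} → Path G Outside u v p → Unique p → All (_∉ vis) p →
                       length p ≤ suc fuel → p ∈ pathsFrom G S fuel vis u
  pathsFrom-complete zero    vis (end _) _ _ _ = here refl
  pathsFrom-complete (suc _) vis (end _) _ _ _ = here refl
  pathsFrom-complete zero vis (step _ _ _) _ _ (s≤s ())
  pathsFrom-complete (suc fuel) vis {u} (step {w = w} {p = r} _ uw π) (u∉ ∷ p!) (_ ∷ w∉vis ∷ r∉vis) (s≤s len) =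
    there (∈-concatMap⁺ next (Any.map (λ { refl → continue }) (∈-allFin w)))
    where
    next : Fin n → List (List (Fin n))
    next y = if adj G u y ∧ not (lookup S y) ∧ not (y ∈ᵇ (u ∷ vis)) then List.map (u ∷_) (pathsFrom G S fuel (u ∷ vis) y) else []
    allowed : (adj G u w ∧ not (lookup S w) ∧ not (w ∈ᵇ (u ∷ vis))) ≡ true
    allowed rewrite uw | All.head (Path-allowed π)
                  | ∈ᵇ-false {w} {u ∷ vis} λ { (here w≡u) → All.head u∉ (sym w≡u) ; (there w∈) → w∉vis w∈ } = refl
    continue : u ∷ w ∷ r ∈ next w
    continue rewrite allowed = ∈-map⁺ (u ∷_) (pathsFrom-complete fuel (u ∷ vis) π p!
      (All.zipWith (λ { (x≢u , x∉vis) → λ { (here x≡u) → x≢u (sym x≡u) ; (there x∈) → x∉vis x∈ } })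
        (u∉ , w∉vis ∷ r∉vis)) len)

  Path-endsAt : ∀ {u v p} → Path G Outside u v p → endsAt v p ≡ true
  Path-endsAt {v = v} {p} π with last? p | Path-last? π
  ... | just w | refl with v Fin.≟ v
  ...   | yes _ = refl
  ...   | no v≢v = ⊥-elim (v≢v refl)

  private
    min-just0 : ∀ (f : List (Fin n) → ℕ) {p ps} → p ∈ ps → f p ≡ 0 →
                foldr (λ q m → min∞ (just (f q)) m) nothing ps ≡ just 0
    min-just0 f {ps = q ∷ qs} (here refl) fp≡0 with foldr (λ q m → min∞ (just (f q)) m) nothing qs
    ... | nothing rewrite fp≡0 = refl
    ... | just _  rewrite fp≡0 = refl
    min-just0 f {ps = q ∷ qs} (there p∈) fp≡0 rewrite min-just0 f p∈ fp≡0 = cong just (ℕ.⊓-zeroʳ (f q))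

  dσ≡0 : (s : Signing G) → ∀ {u v} → ZeroPath G Outside (σ s) u v → dσ G s S u v ≡ just 0
  dσ≡0 s {u} {v} (p , π , p! , p₀) = min-just0 (λ q → ℤ.∣ pathSum (σ s) q ∣)
    (∈-filter⁺ (λ q → T? (endsAt v q))
      (pathsFrom-complete n [] π p! (All.universal (λ _ ()) p) (ℕ.m≤n⇒m≤1+n (Unique⇒length≤ p!)))
      (subst T (sym (Path-endsAt π)) _))
    (cong ℤ.∣_∣ p₀)

  private
    All-concatMap : ∀ {A B : Set} {P : B → Set} {f : A → List B} {xs} → (∀ x → All P (f x)) → All P (concatMap f xs)
    All-concatMap {xs = xs} Pf = All.concat⁺ (All.map⁺ (All.universal Pf xs))

    sum≡0 : ∀ {ms : List ℕ∞} → All (_≡ just 0) ms → foldr _+∞_ (just 0) ms ≡ just 0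
    sum≡0 []           = refl
    sum≡0 (refl ∷ ms₀) rewrite sum≡0 ms₀ = refl

    entry≡0 : (s : Signing G) → (∀ u v → Outside u → Outside v → ZeroPath G Outside (σ s) u v) →
              ∀ u v → All (_≡ just 0) (if lookup S u then [] else if lookup S v then [] else dσ G s S u v ∷ [])
    entry≡0 s zeros u v with lookup S u in su | lookup S v in sv
    ... | true  | _     = []
    ... | false | true  = []
    ... | false | false = dσ≡0 s (zeros u v su sv) ∷ []

  Wσ≡0 : (s : Signing G) → (∀ u v → Outside u → Outside v → ZeroPath G Outside (σ s) u v) → Wσ G s S ≡ just 0
  Wσ≡0 s zeros
    rewrite sum≡0 (All-concatMap {xs = allFin n} (λ u → All-concatMap {xs = allFin n} (entry≡0 s zeros u))) = refl

∣S∣<1⇒empty : ∀ (S : Subset n) → ∣ S ∣ < 1 → ∀ x → lookup S x ≡ false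
∣S∣<1⇒empty (false ∷ _) _        Fin.zero    = refl
∣S∣<1⇒empty (true ∷ _)  (s≤s ()) _
∣S∣<1⇒empty (false ∷ S) ∣S∣<1    (Fin.suc x) = ∣S∣<1⇒empty S ∣S∣<1 x

∣S∣<2⇒empty⊎singleton : ∀ (S : Subset n) → ∣ S ∣ < 2 →
            (∀ x → lookup S x ≡ false) ⊎ Σ (Fin n) λ w → lookup S w ≡ true × ∀ x → x ≢ w → lookup S x ≡ false
∣S∣<2⇒empty⊎singleton []        _ = inj₁ λ ()
∣S∣<2⇒empty⊎singleton (true ∷ S) (s≤s ∣S∣<1) = inj₂ (Fin.zero , refl , λ
  { Fin.zero x≢0 → ⊥-elim (x≢0 refl) ; (Fin.suc x) _ → ∣S∣<1⇒empty S ∣S∣<1 x })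
∣S∣<2⇒empty⊎singleton (false ∷ S) ∣S∣<2 with ∣S∣<2⇒empty⊎singleton S ∣S∣<2
... | inj₁ empty            = inj₁ λ { Fin.zero → refl ; (Fin.suc x) → empty x }
... | inj₂ (w , w∈S , only) = inj₂ (Fin.suc w , w∈S , λ
  { Fin.zero _ → refl ; (Fin.suc x) x≢w → only x (x≢w ∘ cong Fin.suc) })

-- Signed models, routes and embeddings

all-upTo : ∀ (p : ℕ → Bool) {m} → T (all p (upTo m)) → ∀ {i} → i < m → T (p i)
all-upTo p {m} ok i<m = All.lookup (All.all⁺ p (upTo m) ok) (∈-upTo⁺ i<m)

record Model : Set where
  field
    size    : ℕ
    edge    : ℕ → ℕ → Maybe Sign
    removed : ℕ → Bool
open Model

module _ (M : Model) where

  Kept : ℕ → Set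
  Kept i = i < size M × removed M i ≡ false

  kept? : ∀ i → Dec (Kept i)
  kept? i = i ℕ.<? size M ×-dec removed M i Bool.≟ false

  data Route : ℕ → ℕ → List ℕ → ℤ → Set where
    end  : ∀ {i} → Kept i → Route i i (i ∷ []) 0ℤ
    step : ∀ {i j k r s z} → Kept i → edge M i j ≡ just s → Route j k (j ∷ r) z →
           Route i k (i ∷ j ∷ r) (sgn s ℤ.+ z)

  ZeroRoute : ℕ → ℕ → Set
  ZeroRoute i k = Σ (List ℕ) λ r → Route i k r 0ℤ × Unique r

  Route-start : ∀ {i k r z} → Route i k r z → Kept i
  Route-start (end ki)      = ki
  Route-start (step ki _ _) = ki

  Route-bounded : ∀ {i k r z} → Route i k r z → All (_< size M) r
  Route-bounded (end (i< , _))      = i< ∷ []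
  Route-bounded (step (i< , _) _ ρ) = i< ∷ Route-bounded ρ

  Route-++ : ∀ {i j k r r′ z₁ z₂} → Route i j r z₁ → Route j k (j ∷ r′) z₂ → Route i k (r ++ r′) (z₁ ℤ.+ z₂)
  Route-++ {z₂ = z₂} (end _) ρ₂ = subst (Route _ _ _) (sym (ℤ.+-identityˡ z₂)) ρ₂
  Route-++ {z₂ = z₂} (step {s = s} {z = z₁} ki ij ρ₁) ρ₂ =
    subst (Route _ _ _) (sym (ℤ.+-assoc (sgn s) z₁ z₂)) (step ki ij (Route-++ ρ₁ ρ₂))

  route? : ∀ i r → Maybe (Σ ℕ λ k → Σ ℤ λ z → Route i k (i ∷ r) z)
  route? i r with kept? i
  route? i []      | yes ki = just (i , 0ℤ , end ki)
  route? i (j ∷ r) | yes ki with edge M i j in ij | route? j r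
  ... | just s  | just (k , z , ρ) = just (k , sgn s ℤ.+ z , step ki ij ρ)
  ... | just _  | nothing          = nothing
  ... | nothing | _                = nothing
  route? i r | no _ = nothing

  zeroRoute? : ∀ i k r → Maybe (ZeroRoute i k)
  zeroRoute? i k r with route? i r | unique? (i ∷ r)
  ... | just (k′ , z , ρ) | yes r! with k′ ℕ.≟ k | z ℤ.≟ 0ℤ
  ...   | yes refl | yes refl = just (i ∷ r , ρ , r!)
  ...   | _        | _        = nothing
  zeroRoute? i k r | _ | _ = nothing

  -- An unverified depth-first search; its answer is re-checked by zeroRoute?.
  search : ℕ → ℕ → Maybe (List ℕ)
  search i k = go (size M) [] 0ℤ i
    where
    go : ℕ → List ℕ → ℤ → ℕ → Maybe (List ℕ)
    go zero       _       _ _ = nothing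
    go (suc fuel) visited z x =
      if (x ≡ᵇ k) ∧ (ℤ.∣ z ∣ ≡ᵇ 0) then just [] else extend (upTo (size M))
      where
      extend : List ℕ → Maybe (List ℕ)
      extend []       = nothing
      extend (y ∷ ys) = (edge M x y >>= λ s →
        if removed M y ∨ any (y ≡ᵇ_) (x ∷ visited) then nothing
        else Maybe.map (y ∷_) (go fuel (x ∷ visited) (z ℤ.+ sgn s) y)) <∣> extend ys

  findZeroRoute : ∀ i k → Maybe (ZeroRoute i k)
  findZeroRoute i k = search i k >>= zeroRoute? i k

  allPairsRoutable : Bool
  allPairsRoutable = all (λ i → all (λ k → removed M i ∨ removed M k ∨ is-just (findZeroRoute i k))
                                    (upTo (size M))) (upTo (size M))

  routable⇒ZeroRoute : T allPairsRoutable → ∀ {i k} → Kept i → Kept k → ZeroRoute i k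
  routable⇒ZeroRoute ok {i} {k} (i< , iₖ) (k< , kₖ) = to-witness-T (findZeroRoute i k)
    (subst (λ b → T (b ∨ is-just (findZeroRoute i k))) kₖ
      (subst (λ b → T (b ∨ removed M k ∨ is-just (findZeroRoute i k))) iₖ (all-upTo _ (all-upTo _ ok i<) k<)))

record Embedding (M : Model) (G : Graph n) (Allowed : Fin n → Set) (σ : Fin n → Fin n → Sign) : Set where
  field
    vertex    : ℕ → Fin n
    injective : ∀ {i j} → i < size M → j < size M → vertex i ≡ vertex j → i ≡ j
    edge⇒adj  : ∀ {i j s} → i < size M → j < size M → edge M i j ≡ just s →
                Adj G (vertex i) (vertex j) × σ (vertex i) (vertex j) ≡ s
    allowed   : ∀ {i} → Kept M i → Allowed (vertex i)

  private
    path : ∀ {i k r z} → Route M i k r z → Path G Allowed (vertex i) (vertex k) (List.map vertex r)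
    path (end ki)         = end (allowed ki)
    path (step ki ij ρ) = step (allowed ki) (proj₁ (edge⇒adj (proj₁ ki) (proj₁ (Route-start M ρ)) ij)) (path ρ)

    sum : ∀ {i k r z} → Route M i k r z → pathSum σ (List.map vertex r) ≡ z
    sum (end _)          = refl
    sum (step ki ij ρ) = cong₂ (λ s z → sgn s ℤ.+ z) (proj₂ (edge⇒adj (proj₁ ki) (proj₁ (Route-start M ρ)) ij)) (sum ρ)

    map-unique : ∀ {r} → All (_< size M) r → Unique r → Unique (List.map vertex r)
    map-unique []           []          = []
    map-unique (x< ∷ r<) (x∉r ∷ r!) = All.map⁺ (All.zipWith (λ { (y< , x≢y) e → x≢y (injective x< y< e) }) (r< , x∉r))
                                      ∷ map-unique r< r!

  zeroPath : ∀ {i k} → ZeroRoute M i k → ZeroPath G Allowed σ (vertex i) (vertex k)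
  zeroPath (r , ρ , r!) = List.map vertex r , path ρ , map-unique (Route-bounded M ρ) r! , sum ρ

negateIf : Bool → Sign → Sign
negateIf true  = Sign.opposite
negateIf false = id

switchAt : Fin n → (Fin n → Fin n → Sign) → Fin n → Fin n → Sign
switchAt w σ a b = negateIf (⌊ a Fin.≟ w ⌋ ∨ ⌊ b Fin.≟ w ⌋) (σ a b)

switch : ℕ → Model → Model
switch c M = record M { edge = λ i j → Maybe.map (negateIf (⌊ i ℕ.≟ c ⌋ ∨ ⌊ j ℕ.≟ c ⌋)) (edge M i j) }

Embedding-switch : ∀ {M} {G : Graph n} {Allowed σ} (e : Embedding M G Allowed σ) → ∀ {c} → c < size M →
                   Embedding (switch c M) G Allowed (switchAt (Embedding.vertex e c) σ)
Embedding-switch {M = M} {G} {σ = σ} e {c} c< = record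
  { vertex    = vertex
  ; injective = injective
  ; edge⇒adj  = edge⇒adj′
  ; allowed   = allowed
  }
  where
  open Embedding e
  at-c : ∀ {i} → i < size M → ⌊ i ℕ.≟ c ⌋ ≡ ⌊ vertex i Fin.≟ vertex c ⌋
  at-c {i} i< with i ℕ.≟ c | vertex i Fin.≟ vertex c
  ... | yes _    | yes _  = refl
  ... | yes refl | no ne  = ⊥-elim (ne refl)
  ... | no i≢c   | yes e  = ⊥-elim (i≢c (injective i< c< e))
  ... | no _     | no _   = refl
  edge⇒adj′ : ∀ {i j s} → i < size M → j < size M → edge (switch c M) i j ≡ just s →
              Adj G (vertex i) (vertex j) × switchAt (vertex c) σ (vertex i) (vertex j) ≡ s
  edge⇒adj′ {i} {j} i< j< ij with edge M i j in ij₀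
  edge⇒adj′ {i} {j} i< j< refl | just s₀ with edge⇒adj i< j< ij₀
  ... | adj , σ≡s₀ rewrite at-c i< | at-c j< =
    adj , cong (negateIf (⌊ vertex i Fin.≟ vertex c ⌋ ∨ ⌊ vertex j Fin.≟ vertex c ⌋)) σ≡s₀

switchAt-sym : ∀ {σ : Fin n → Fin n → Sign} → (∀ a b → σ a b ≡ σ b a) → ∀ w a b → switchAt w σ a b ≡ switchAt w σ b a
switchAt-sym {σ = σ} σ-sym w a b = cong₂ negateIf (Bool.∨-comm ⌊ a Fin.≟ w ⌋ ⌊ b Fin.≟ w ⌋) (σ-sym a b)

-- Ladders

-- The signed square of a path, a ladder: consecutive vertices are joined positively, vertices at distance 2 negatively.
ladderEdge : ℕ → ℕ → Maybe Sign
ladderEdge zero    j       = gap j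
  where
  gap : ℕ → Maybe Sign
  gap 1 = just Sign.+
  gap 2 = just Sign.-
  gap _ = nothing
ladderEdge (suc i) zero    = ladderEdge zero (suc i)
ladderEdge (suc i) (suc j) = ladderEdge i j

ladder : ℕ → Model
ladder L = record { size = L ; edge = ladderEdge ; removed = λ _ → false }

ladderEdge-shiftˡ : ∀ o {i j} → ladderEdge (o + i) (o + j) ≡ ladderEdge i j
ladderEdge-shiftˡ zero            = refl
ladderEdge-shiftˡ (suc o) {i} {j} = ladderEdge-shiftˡ o {i} {j}

ladderEdge-shift : ∀ o {i j} → ladderEdge (i + o) (j + o) ≡ ladderEdge i j
ladderEdge-shift o {i} {j} rewrite ℕ.+-comm i o | ℕ.+-comm j o = ladderEdge-shiftˡ o

Route-shift : ∀ o {L L′ i k r z} → L + o ≤ L′ → Route (ladder L) i k r z →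
              Route (ladder L′) (i + o) (k + o) (List.map (_+ o) r) z
Route-shift o le (end (i< , _)) = end (ℕ.≤-trans (ℕ.+-monoˡ-< o i<) le , refl)
Route-shift o le (step {i} {j} (i< , _) ij ρ) =
  step (ℕ.≤-trans (ℕ.+-monoˡ-< o i<) le , refl) (trans (ladderEdge-shift o {i} {j}) ij) (Route-shift o le ρ)

ZeroRoute-shift : ∀ o {L L′ i k} → L + o ≤ L′ → ZeroRoute (ladder L) i k → ZeroRoute (ladder L′) (i + o) (k + o)
ZeroRoute-shift o le (r , ρ , r!) = List.map (_+ o) r , Route-shift o le ρ , Unique.map⁺ (ℕ.+-cancelʳ-≡ o _ _) r!

Route-widen : ∀ {L L′ i k r z} → L ≤ L′ → Route (ladder L) i k r z → Route (ladder L′) i k r z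
Route-widen le (end (i< , _))       = end (ℕ.≤-trans i< le , refl)
Route-widen le (step (i< , _) ij ρ) = step (ℕ.≤-trans i< le , refl) ij (Route-widen le ρ)

Route-head : ∀ {M i k x t z} → Route M i k (x ∷ t) z → x ≡ i
Route-head (end _)      = refl
Route-head (step _ _ _) = refl

Window : ℕ → Set
Window d = ZeroRoute (ladder (suc d)) 0 d

Window-+ : ∀ {a b} → Window a → Window b → Window (b + a)
Window-+ {a} {b} (r₁ , ρ₁ , r₁!) (x ∷ t , ρ₂ , x∉t ∷ t!) with Route-head ρ₂
... | refl = r₁ ++ List.map (_+ a) t ,
             Route-++ (ladder _) (Route-widen (s≤s (ℕ.m≤n+m a b)) ρ₁) (Route-shift a ℕ.≤-refl ρ₂) ,
             Unique.++⁺ r₁! (Unique.map⁺ (ℕ.+-cancelʳ-≡ a _ _) t!) disjoint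
  where
  disjoint : ∀ {y} → y ∈ r₁ × y ∈ List.map (_+ a) t → ⊥
  disjoint (y∈r₁ , y∈t) with ∈-map⁻ (_+ a) y∈t
  ... | z , z∈t , refl with z | All.lookup x∉t z∈t
  ...   | zero  | 0≢0 = 0≢0 refl
  ...   | suc z | _   = ℕ.<-irrefl refl (ℕ.≤-trans (ℕ.≤-pred (All.lookup (Route-bounded _ ρ₁) y∈r₁)) (ℕ.m≤n+m a z))

window3 : Window 3
window3 = from-just (findZeroRoute (ladder 4) 0 3)

window4 : Window 4
window4 = from-just (findZeroRoute (ladder 5) 0 4)

-- Every span d ≥ 6 is a sum of 3s and 4s.
window≥6 : ∀ m → Window (6 + m)
window≥6 0                   = Window-+ window3 window3
window≥6 1                   = Window-+ window4 window3
window≥6 2                   = Window-+ window4 window4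
window≥6 (suc (suc (suc m))) = Window-+ (window≥6 m) window3

-- Spans 1, 2 and 5 admit no zero route inside [a, b]; they detour through vertices beyond b, or before a.
ladder-zeroRoute : ∀ {L} → 7 ≤ L → ∀ {a b} → a < b → b < L → ZeroRoute (ladder L) a b
ladder-zeroRoute {L} 7≤L {a} {b} a<b b<L =
  subst (ZeroRoute (ladder L) a) eq (span (ℕ.pred (b ∸ a)) a (subst (_< L) (sym eq) b<L))
  where
  eq : suc (ℕ.pred (b ∸ a)) + a ≡ b
  eq = trans (cong (_+ a) (ℕ.suc-pred (b ∸ a) {{ℕ.>-nonZero (ℕ.m<n⇒0<n∸m a<b)}})) (ℕ.m∸n+n≡m (ℕ.<⇒≤ a<b))
  span : ∀ d a → suc d + a < L → ZeroRoute (ladder L) a (suc d + a)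
  span 0 zero          _  = ZeroRoute-shift 0 (ℕ.≤-trans (ℕ.m≤n+m 3 4) 7≤L) (from-just (findZeroRoute (ladder 3) 0 1))
  span 0 (suc a)       lt = ZeroRoute-shift a lt (from-just (findZeroRoute (ladder 3) 1 2))
  span 1 zero          _  = ZeroRoute-shift 0 (ℕ.≤-trans (ℕ.m≤n+m 5 2) 7≤L) (from-just (findZeroRoute (ladder 5) 0 2))
  span 1 1             _  = ZeroRoute-shift 1 (ℕ.≤-trans (ℕ.m≤n+m 6 1) 7≤L) (from-just (findZeroRoute (ladder 5) 0 2))
  span 1 (suc (suc a)) lt = ZeroRoute-shift a lt (from-just (findZeroRoute (ladder 5) 2 4))
  span 2 a             lt = ZeroRoute-shift a lt window3
  span 3 a             lt = ZeroRoute-shift a lt window4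
  span 4 zero          _  = ZeroRoute-shift 0 7≤L (from-just (findZeroRoute (ladder 7) 0 5))
  span 4 (suc a)       lt = ZeroRoute-shift a lt (from-just (findZeroRoute (ladder 7) 1 6))
  span (suc (suc (suc (suc (suc m))))) a lt = ZeroRoute-shift a lt (window≥6 m)

data LadderStep : ℕ → ℕ → Sign → Set where
  forward₁  : ∀ {i} → LadderStep i (suc i) Sign.+
  forward₂  : ∀ {i} → LadderStep i (suc (suc i)) Sign.-
  backward₁ : ∀ {j} → LadderStep (suc j) j Sign.+
  backward₂ : ∀ {j} → LadderStep (suc (suc j)) j Sign.-

ladderEdge⇒step : ∀ {i j s} → ladderEdge i j ≡ just s → LadderStep i j s
ladderEdge⇒step {zero}  {1}             refl = forward₁
ladderEdge⇒step {zero}  {2}             refl = forward₂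
ladderEdge⇒step {zero}  {zero}          ()
ladderEdge⇒step {zero}  {suc (suc (suc _))} ()
ladderEdge⇒step {1}     {zero}          refl = backward₁
ladderEdge⇒step {2}     {zero}          refl = backward₂
ladderEdge⇒step {suc (suc (suc _))} {zero} ()
ladderEdge⇒step {suc i} {suc j} e with ladderEdge⇒step {i} {j} e
... | forward₁  = forward₁
... | forward₂  = forward₂
... | backward₁ = backward₁
... | backward₂ = backward₂

-- Squares of trees

_∈?_ : ∀ (x : Fin n) xs → Dec (x ∈ xs)
_∈?_ {n} = DecMembership._∈?_ (Fin._≟_ {n})

missing : (L : List (Fin n)) → length L < n → Σ (Fin n) (_∉ L)
missing L |L|<n with Fin.any? (λ w → ¬? (w ∈? L))
... | yes found = found
... | no none = ⊥-elim (ℕ.<⇒≱ |L|<n (Fin.injective⇒≤ index-injective))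
  where
  present : ∀ w → w ∈ L
  present w with w ∈? L
  ... | yes w∈L = w∈L
  ... | no  w∉L = ⊥-elim (none (w , w∉L))
  index-injective : ∀ {a b} → Any.index (present a) ≡ Any.index (present b) → a ≡ b
  index-injective {a} {b} e =
    trans (Any.lookup-index (present a)) (trans (cong (List.lookup L) e) (sym (Any.lookup-index (present b))))

leaving-edge : ∀ {G : Graph n} {L a w} → Walk G a w → a ∈ L → w ∉ L →
               Σ (Fin n) λ y → Σ (Fin n) λ x → y ∈ L × x ∉ L × Adj G y x
leaving-edge (stop _) a∈L w∉L = ⊥-elim (w∉L a∈L)
leaving-edge {L = L} (step {w = b} ab ω) a∈L w∉L with b ∈? L
... | yes b∈L = leaving-edge ω b∈L w∉L
... | no  b∉L = _ , b , a∈L , b∉L , ab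

module _ {G : Graph n} {Allowed : Fin n → Set} where

  private
    suffix : ∀ {w v q u} → Path G Allowed w v q → Unique q → u ∈ q →
             Σ (List (Fin n)) λ q′ → Path G Allowed u v q′ × Unique q′
    suffix π@(end _)      q!       (here refl) = _ , π , q!
    suffix π@(step _ _ _) q!       (here refl) = _ , π , q!
    suffix (step _ _ π)   (_ ∷ q!) (there u∈q) = suffix π q! u∈q

  simplePath : ∀ {u v p} → Path G Allowed u v p → Σ (List (Fin n)) λ q → Path G Allowed u v q × Unique q
  simplePath (end a) = _ , end a , [] ∷ []
  simplePath {u} (step a uw π) with simplePath π
  ... | q , ψ , q! with u ∈? q
  ...   | yes u∈q = suffix ψ q! u∈q
  ...   | no  u∉q = u ∷ q , Path-cons a uw ψ , All.¬Any⇒All¬ q u∉q ∷ q!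

Walk⇒Path : ∀ {G : Graph n} {u v} → Walk G u v → Σ (List (Fin n)) (Path G (λ _ → ⊤) u v)
Walk⇒Path (stop _)   = _ , end _
Walk⇒Path (step a ω) with Walk⇒Path ω
... | p , π = _ , Path-cons _ a π

Adj-irrefl : ∀ {G : Graph n} {u v} → Adj G u v → u ≢ v
Adj-irrefl {G = G} {u} uu refl with trans (sym (irrefl G u)) uu
... | ()

CycAdj-irrefl : ∀ {k} → 2 ≤ k → ∀ i → ¬ CycAdj k i i
CycAdj-irrefl _ i (inj₁ i+1≡i)                = ℕ.1+n≢n i+1≡i
CycAdj-irrefl _ i (inj₂ (inj₁ i+1≡i))         = ℕ.1+n≢n i+1≡i
CycAdj-irrefl 2≤k i (inj₂ (inj₂ (inj₁ (i≡0 , i+1≡k)))) = ℕ.<-irrefl (trans (cong suc (sym i≡0)) i+1≡k) 2≤k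
CycAdj-irrefl 2≤k i (inj₂ (inj₂ (inj₂ (i≡0 , i+1≡k)))) = ℕ.<-irrefl (trans (cong suc (sym i≡0)) i+1≡k) 2≤k

acyclic⇒triangle-free : ∀ {G : Graph n} → ¬ HasCycle G → ∀ {a b c} → Adj G a b → Adj G b c → a ≢ c → ¬ Adj G a c
acyclic⇒triangle-free {n} {G = G} acyclic {a} {b} {c} ab bc a≢c ac =
  acyclic (3 , ℕ.≤-refl , f , injective ,
    λ i j i~j → adjacent i j λ { refl → CycAdj-irrefl (s≤s (s≤s z≤n)) i i~j })
  where
  f : Fin 3 → Fin n
  f Fin.zero                     = a
  f (Fin.suc Fin.zero)           = b
  f (Fin.suc (Fin.suc Fin.zero)) = c
  adjacent : ∀ i j → i ≢ j → Adj G (f i) (f j)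
  adjacent Fin.zero                      (Fin.suc Fin.zero)             _ = ab
  adjacent Fin.zero                      (Fin.suc (Fin.suc Fin.zero))   _ = ac
  adjacent (Fin.suc Fin.zero)            (Fin.suc (Fin.suc Fin.zero))   _ = bc
  adjacent (Fin.suc Fin.zero)            Fin.zero                       _ = Adj-sym {G = G} ab
  adjacent (Fin.suc (Fin.suc Fin.zero))  Fin.zero                       _ = Adj-sym {G = G} ac
  adjacent (Fin.suc (Fin.suc Fin.zero))  (Fin.suc Fin.zero)             _ = Adj-sym {G = G} bc
  adjacent Fin.zero                      Fin.zero                       0≢0 = ⊥-elim (0≢0 refl)
  adjacent (Fin.suc Fin.zero)            (Fin.suc Fin.zero)             1≢1 = ⊥-elim (1≢1 refl)
  adjacent (Fin.suc (Fin.suc Fin.zero))  (Fin.suc (Fin.suc Fin.zero))   2≢2 = ⊥-elim (2≢2 refl)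
  injective : ∀ {i j} → f i ≡ f j → i ≡ j
  injective {i} {j} e with i Fin.≟ j
  ... | yes i≡j = i≡j
  ... | no  i≢j = ⊥-elim (Adj-irrefl {G = G} (adjacent i j i≢j) e)

nth : ∀ {A : Set} → A → List A → ℕ → A
nth d []       _       = d
nth d (x ∷ _)  zero    = x
nth d (_ ∷ xs) (suc i) = nth d xs i

index-of : ∀ {A : Set} {x} {xs : List A} → x ∈ xs → ℕ
index-of x∈ = toℕ (Any.index x∈)

index-of< : ∀ {A : Set} {x} {xs : List A} (x∈ : x ∈ xs) → index-of x∈ < length xs
index-of< x∈ = Fin.toℕ<n (Any.index x∈)

module _ {A : Set} (d : A) where

  nth-∈ : ∀ {xs : List A} {i} → i < length xs → nth d xs i ∈ xs
  nth-∈ {_ ∷ _}  {zero}  _        = here refl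
  nth-∈ {_ ∷ xs} {suc i} (s≤s i<) = there (nth-∈ {xs} i<)

  nth-injective : ∀ {xs : List A} → Unique xs → ∀ {i j} → i < length xs → j < length xs → nth d xs i ≡ nth d xs j → i ≡ j
  nth-injective {_ ∷ _}  _           {zero}  {zero}  _        _        _ = refl
  nth-injective {_ ∷ xs} (x∉xs ∷ _)  {zero}  {suc j} _        (s≤s j<) e = ⊥-elim (All.lookup x∉xs (nth-∈ {xs} j<) e)
  nth-injective {_ ∷ xs} (x∉xs ∷ _)  {suc i} {zero}  (s≤s i<) _        e = ⊥-elim (All.lookup x∉xs (nth-∈ {xs} i<) (sym e))
  nth-injective {_ ∷ xs} (_ ∷ xs!)   {suc i} {suc j} (s≤s i<) (s≤s j<) e = cong suc (nth-injective xs! i< j< e)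

  nth-index-of : ∀ {x} {xs : List A} (x∈ : x ∈ xs) → nth d xs (index-of x∈) ≡ x
  nth-index-of (here refl) = refl
  nth-index-of (there x∈)  = nth-index-of x∈

  nth-∷ʳ : ∀ {xs : List A} {x i} → i < length xs → nth d (xs ∷ʳ x) i ≡ nth d xs i
  nth-∷ʳ {_ ∷ _} {i = zero}  _        = refl
  nth-∷ʳ {_ ∷ xs} {i = suc i} (s≤s i<) = nth-∷ʳ {xs} i<

  nth-∷ʳ-length : ∀ (xs : List A) {x} → nth d (xs ∷ʳ x) (length xs) ≡ x
  nth-∷ʳ-length []       = refl
  nth-∷ʳ-length (_ ∷ xs) = nth-∷ʳ-length xs

Unique-∷ʳ : ∀ {A : Set} {xs : List A} {x} → Unique xs → x ∉ xs → Unique (xs ∷ʳ x)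
Unique-∷ʳ xs! x∉xs = Unique.++⁺ xs! ([] ∷ []) λ { (x∈xs , here refl) → x∉xs x∈xs }

Unique-covers : ∀ {xs : List (Fin n)} → Unique xs → length xs ≡ n → ∀ w → w ∈ xs
Unique-covers {n} {xs} xs! |xs|≡n w with w ∈? xs
... | yes w∈xs = w∈xs
... | no  w∉xs = ⊥-elim (ℕ.<-irrefl refl (ℕ.≤-trans (s≤s (ℕ.≤-reflexive (sym |xs|≡n)))
                                           (Unique⇒length≤ (All.¬Any⇒All¬ xs w∉xs ∷ xs!))))

joined : List (ℕ × ℕ) → ℕ → ℕ → Bool
joined es i j = any (λ e → ((proj₁ e ≡ᵇ i) ∧ (proj₂ e ≡ᵇ j)) ∨ ((proj₁ e ≡ᵇ j) ∧ (proj₂ e ≡ᵇ i))) es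

-- The square of the tree with edge list es on the indices 0 … m - 1, signed like σT below.
treeSquare : List (ℕ × ℕ) → ℕ → Model
treeSquare es m = record
  { size    = m
  ; edge    = λ i j → if joined es i j then just Sign.+
                      else if not (i ≡ᵇ j) ∧ any (λ k → joined es i k ∧ joined es k j) (upTo m) then just Sign.-
                      else nothing
  ; removed = λ _ → false
  }

Path-last : ∀ {G : Graph n} {A d u v p} → Path G A u v p → nth d p (ℕ.pred (length p)) ≡ v
Path-last         (end _)      = refl
Path-last {d = d} (step _ _ π) = Path-last {d = d} π

module TreeSquare (T G : Graph n) (acyclic : ¬ HasCycle T) (T²⊆G : ∀ u v → SqRel (Adj T) u v → Adj G u v) where

  σT : Fin n → Fin n → Sign
  σT a b = if adj T a b then Sign.+ else Sign.-

  signing : Signing G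
  signing = record { σ = σT ; σsym = λ a b → cong (if_then Sign.+ else Sign.-) (Graph.sym T a b) }

  Signed : Sign → Fin n → Fin n → Set
  Signed s a b = Adj G a b × σT a b ≡ s

  Signed-sym : ∀ {s a b} → Signed s a b → Signed s b a
  Signed-sym {a = a} {b} (ab , σab) = Adj-sym {G = G} ab , trans (Signing.σsym signing b a) σab

  positive : ∀ {a b} → Adj T a b → Signed Sign.+ a b
  positive {a} {b} ab = T²⊆G a b (Adj-irrefl {G = T} ab , inj₁ ab) , cong (if_then Sign.+ else Sign.-) ab

  negative : ∀ {a b c} → Adj T a b → Adj T b c → a ≢ c → Signed Sign.- a c
  negative {a} {b} {c} ab bc a≢c =
    T²⊆G a c (a≢c , inj₂ (b , ab , bc)) ,
    cong (if_then Sign.+ else Sign.-) (Bool.¬-not (acyclic⇒triangle-free {G = T} acyclic ab bc a≢c))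

  signed-along₀ : ∀ d {u v p} → Path T (λ _ → ⊤) u v p → Unique p → ∀ {j s} → j < length p →
           ladderEdge 0 j ≡ just s → Signed s (nth d p 0) (nth d p j)
  signed-along₀ d (step _ uw _)             _        {1} _ refl = positive uw
  signed-along₀ d (step _ uw (step _ wx _)) (u∉ ∷ _) {2} _ refl = negative uw wx (All.lookup u∉ (there (here refl)))
  signed-along₀ d (end _)                   _        {suc _} (s≤s ()) _
  signed-along₀ d (step _ _ (end _))        _        {2} (s≤s (s≤s ())) _
  signed-along₀ d _ _ {0} _ ()
  signed-along₀ d _ _ {suc (suc (suc _))} _ ()

  signed-along : ∀ d {u v p} → Path T (λ _ → ⊤) u v p → Unique p → ∀ {i j s} → i < length p → j < length p →
          ladderEdge i j ≡ just s → Signed s (nth d p i) (nth d p j)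
  signed-along d π p! {0}     {j}     _ j< e = signed-along₀ d π p! j< e
  signed-along d π p! {suc i} {0}     i< _ e = Signed-sym (signed-along₀ d π p! i< e)
  signed-along d (step _ _ π) (_ ∷ p!) {suc i} {suc j} (s≤s i<) (s≤s j<) e = signed-along d π p! i< j< e
  signed-along d (end _) _ {suc _} {suc _} (s≤s ()) _ _

  ladderAlong : ∀ {u v p} → Path T (λ _ → ⊤) u v p → Unique p → Embedding (ladder (length p)) G (λ _ → ⊤) σT
  ladderAlong {u} {p = p} π p! = record
    { vertex    = nth u p
    ; injective = nth-injective u p!
    ; edge⇒adj  = signed-along u π p!
    ; allowed   = λ _ → tt
    }

  module _ (d : Fin n) (V : List (Fin n)) (V! : Unique V) (es : List (ℕ × ℕ))
           (drawn : All (λ e → Adj T (nth d V (proj₁ e)) (nth d V (proj₂ e))) es) where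

    private
      joined⇒adj : ∀ {es′} → All (λ e → Adj T (nth d V (proj₁ e)) (nth d V (proj₂ e))) es′ →
                   ∀ {i j} → Bool.T (joined es′ i j) → Adj T (nth d V i) (nth d V j)
      joined⇒adj {(a , b) ∷ _} (ab ∷ rest) {i} {j} t with Bool.T-∨ .to t
      ... | inj₂ t′ = joined⇒adj rest t′
      ... | inj₁ t′ with Bool.T-∨ .to t′
      ...   | inj₁ a,b≡i,j = let (a≡i , b≡j) = Bool.T-∧ .to a,b≡i,j in
                             subst₂ (λ x y → Adj T (nth d V x) (nth d V y)) (ℕ.≡ᵇ⇒≡ a i a≡i) (ℕ.≡ᵇ⇒≡ b j b≡j) ab
      ...   | inj₂ a,b≡j,i = let (a≡j , b≡i) = Bool.T-∧ .to a,b≡j,i in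
                             subst₂ (λ x y → Adj T (nth d V x) (nth d V y)) (ℕ.≡ᵇ⇒≡ b i b≡i) (ℕ.≡ᵇ⇒≡ a j a≡j)
                               (Adj-sym {G = T} ab)

      square⇒signed : ∀ {i j s} → i < length V → j < length V → Model.edge (treeSquare es (length V)) i j ≡ just s →
                      Signed s (nth d V i) (nth d V j)
      square⇒signed {i} {j} i< j< ij with joined es i j in ij-joined
      square⇒signed {i} {j} i< j< refl | true = positive (joined⇒adj drawn (Bool.T-≡ .from ij-joined))
      ... | false with not (i ≡ᵇ j) ∧ any (λ k → joined es i k ∧ joined es k j) (upTo (length V)) in ij-square
      square⇒signed {i} {j} i< j< refl | false | true
        with (i≢j , via) ← Bool.T-∧ .to (Bool.T-≡ .from ij-square)
        with (k , ik,kj) ← Any.satisfied (Any.any⁻ (λ k → joined es i k ∧ joined es k j) (upTo (length V)) via)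
        with (ik , kj) ← Bool.T-∧ .to ik,kj =
        negative (joined⇒adj drawn ik) (joined⇒adj drawn kj) λ e →
          subst Bool.T (Bool.T-not-≡ .to i≢j) (ℕ.≡⇒≡ᵇ i j (nth-injective d V! i< j< e))
      square⇒signed {i} {j} i< j< () | false | false

    drawing : Embedding (treeSquare es (length V)) G (λ _ → ⊤) σT
    drawing = record
      { vertex    = nth d V
      ; injective = nth-injective d V!
      ; edge⇒adj  = square⇒signed
      ; allowed   = λ _ → tt
      }

    drawing-zeroPath : ∀ {i k} → Bool.T (is-just (findZeroRoute (treeSquare es (length V)) i k)) →
                       ZeroPath G (λ _ → ⊤) σT (nth d V i) (nth d V k)
    drawing-zeroPath found = Embedding.zeroPath drawing (to-witness-T _ found)

  leaf-edge : ∀ d {V y x} (y∈ : y ∈ V) → Adj T y x → Adj T (nth d (V ∷ʳ x) (index-of y∈)) (nth d (V ∷ʳ x) (length V))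
  leaf-edge d {V} {y} {x} y∈ yx =
    subst₂ (Adj T) (sym (trans (nth-∷ʳ d {V} (index-of< y∈)) (nth-index-of d y∈))) (sym (nth-∷ʳ-length d V)) yx

  -- A path 0 – 1 – ⋯ with leaves attached at a (and b); each needs a zero route between the two ends of the path.
  routes-P₂+leaf : ℕ → Bool
  routes-P₂+leaf a = is-just (findZeroRoute (treeSquare ((0 , 1) ∷ (a , 2) ∷ []) 3) 0 1)

  routes-P₃+leaves : ℕ → ℕ → Bool
  routes-P₃+leaves a b = is-just (findZeroRoute (treeSquare ((0 , 1) ∷ (1 , 2) ∷ (a , 3) ∷ (b , 4) ∷ []) 5) 0 2)

  routes-P₆+leaf : ℕ → Bool
  routes-P₆+leaf a = is-just (findZeroRoute (treeSquare ((0 , 1) ∷ (1 , 2) ∷ (2 , 3) ∷ (3 , 4) ∷ (4 , 5) ∷ (a , 6) ∷ []) 7) 0 5)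

  P₂+leaf-routable : ∀ {a} → a < 2 → Bool.T (routes-P₂+leaf a)
  P₂+leaf-routable = all-upTo routes-P₂+leaf {2} _

  P₃+leaves-routable : ∀ {a b} → a < 3 → b < 4 → Bool.T (routes-P₃+leaves a b)
  P₃+leaves-routable {a} a< = all-upTo (routes-P₃+leaves a) (all-upTo (λ a → all (routes-P₃+leaves a) (upTo 4)) {3} _ a<)

  P₆+leaf-routable : ∀ {a} → a < 6 → Bool.T (routes-P₆+leaf a)
  P₆+leaf-routable = all-upTo routes-P₆+leaf {6} _

  module _ (connected : Connected T) where

    Leaf : List (Fin n) → Set
    Leaf V = Σ (Fin n) λ y → Σ (Fin n) λ x → y ∈ V × x ∉ V × Adj T y x

    leaf : ∀ {u} V → u ∈ V → length V < n → Leaf V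
    leaf V u∈V |V|<n with missing V |V|<n
    ... | w , w∉V = leaving-edge (connected _ w) u∈V w∉V

    zeroPath-along : ∀ {u v p} → Path T (λ _ → ⊤) u v p → Unique p → 5 ≤ n → (length p ≡ 6 → 6 < n) →
                     ZeroPath G (λ _ → ⊤) σT u v
    zeroPath-along (end _) _ _ _ = ZeroPath-refl tt
    zeroPath-along {u} {v} (step _ uv (end _)) p! 5≤n _
      with (y , x , y∈ , x∉ , yx) ← leaf (u ∷ v ∷ []) (here refl) (ℕ.≤-trans (ℕ.m≤m+n 3 2) 5≤n) =
      drawing-zeroPath u (u ∷ v ∷ x ∷ []) (Unique-∷ʳ p! x∉) ((0 , 1) ∷ (index-of y∈ , 2) ∷ [])
        (uv ∷ leaf-edge u y∈ yx ∷ []) {0} {1} (P₂+leaf-routable (index-of< y∈))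
    zeroPath-along {u} {v} (step {w = c} _ uc (step _ cv (end _))) p! 5≤n _
      with (y₁ , x₁ , y₁∈ , x₁∉ , y₁x₁) ← leaf (u ∷ c ∷ v ∷ []) (here refl) (ℕ.<-trans (ℕ.n<1+n 3) 5≤n)
      with (y₂ , x₂ , y₂∈ , x₂∉ , y₂x₂) ← leaf (u ∷ c ∷ v ∷ x₁ ∷ []) (here refl) 5≤n =
      drawing-zeroPath u (u ∷ c ∷ v ∷ x₁ ∷ x₂ ∷ []) (Unique-∷ʳ (Unique-∷ʳ p! x₁∉) x₂∉)
        ((0 , 1) ∷ (1 , 2) ∷ (index-of y₁∈ , 3) ∷ (index-of y₂∈ , 4) ∷ [])
        (uc ∷ cv ∷ subst (λ z → Adj T z x₁) (sym (nth-∷ʳ u (ℕ.m<n⇒m<1+n (index-of< y₁∈)))) (leaf-edge u y₁∈ y₁x₁)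
            ∷ leaf-edge u y₂∈ y₂x₂ ∷ [])
        {0} {2} (P₃+leaves-routable (index-of< y₁∈) (index-of< y₂∈))
    zeroPath-along π@(step _ _ (step _ _ (step _ _ (end _)))) p! _ _ =
      Embedding.zeroPath (ladderAlong π p!) window3
    zeroPath-along π@(step _ _ (step _ _ (step _ _ (step _ _ (end _))))) p! _ _ =
      Embedding.zeroPath (ladderAlong π p!) window4
    zeroPath-along {u}
      (step {w = p₁} _ a₀ (step {w = p₂} _ a₁ (step {w = p₃} _ a₂ (step {w = p₄} _ a₃ (step {w = p₅} _ a₄ (end _)))))) p! _ 6<n
      with (y , x , y∈ , x∉ , yx) ← leaf (u ∷ p₁ ∷ p₂ ∷ p₃ ∷ p₄ ∷ p₅ ∷ []) (here refl) (6<n refl) =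
      drawing-zeroPath u (u ∷ p₁ ∷ p₂ ∷ p₃ ∷ p₄ ∷ p₅ ∷ x ∷ []) (Unique-∷ʳ p! x∉)
        ((0 , 1) ∷ (1 , 2) ∷ (2 , 3) ∷ (3 , 4) ∷ (4 , 5) ∷ (index-of y∈ , 6) ∷ [])
        (a₀ ∷ a₁ ∷ a₂ ∷ a₃ ∷ a₄ ∷ leaf-edge u y∈ yx ∷ []) {0} {5} (P₆+leaf-routable (index-of< y∈))
    zeroPath-along {u} {v} π@(step _ _ (step _ _ (step _ _ (step _ _ (step _ _ (step {p = r} _ _ _)))))) p! _ _ =
      subst (ZeroPath G (λ _ → ⊤) σT u) (Path-last π) (Embedding.zeroPath (ladderAlong π p!) (window≥6 (length r)))

    treePath : ∀ u v → Σ (List (Fin n)) λ p → Path T (λ _ → ⊤) u v p × Unique p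
    treePath u v = simplePath (proj₂ (Walk⇒Path (connected u v)))

    P₆-switched-routable : Bool.T (allPairsRoutable (switch 0 (ladder 6)))
    P₆-switched-routable = _

    -- In the square of a six-vertex path σT has no zero route between the ends; switching at one end repairs this.
    switchedP₆ : ∀ {u₀ v₀ p} → Path T (λ _ → ⊤) u₀ v₀ p → Unique p → length p ≡ 6 → n ≡ 6 →
                 ∀ u v → ZeroPath G (λ _ → ⊤) (switchAt u₀ σT) u v
    switchedP₆ {u₀} {p = p} π@(step _ _ _) p! |p|≡6 n≡6 u v
      with u∈ ← Unique-covers p! (trans |p|≡6 (sym n≡6)) u
      with v∈ ← Unique-covers p! (trans |p|≡6 (sym n≡6)) v =
      subst₂ (ZeroPath G (λ _ → ⊤) (switchAt u₀ σT)) (nth-index-of u₀ u∈) (nth-index-of u₀ v∈)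
        (Embedding.zeroPath switched (routable⇒ZeroRoute _ routable (index-of< u∈ , refl) (index-of< v∈ , refl)))
      where
      switched : Embedding (switch 0 (ladder (length p))) G (λ _ → ⊤) (switchAt (nth u₀ p 0) σT)
      switched = Embedding-switch (ladderAlong π p!) (s≤s z≤n)
      routable : Bool.T (allPairsRoutable (switch 0 (ladder (length p))))
      routable = subst (λ L → Bool.T (allPairsRoutable (switch 0 (ladder L)))) (sym |p|≡6) P₆-switched-routable

    standardCanceling : 5 ≤ n → (∀ u v → length (proj₁ (treePath u v)) ≡ 6 → 6 < n) → Canceling G
    standardCanceling 5≤n no-P₆ = signing , λ S ∣S∣<1 → Wσ≡0 G S signing λ u v _ _ →
      let (_ , π , p!) = treePath u v in
      ZeroPath-weaken (λ _ → ∣S∣<1⇒empty S ∣S∣<1 _) (zeroPath-along π p! 5≤n (no-P₆ u v))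

    canceling : 5 ≤ n → Canceling G
    canceling 5≤n with Fin.any? (λ u → Fin.any? (λ v → length (proj₁ (treePath u v)) ℕ.≟ 6)) | n ℕ.≟ 6
    ... | yes (u₀ , v₀ , |p|≡6) | yes n≡6 =
      switched , λ S ∣S∣<1 → Wσ≡0 G S switched λ u v _ _ →
        ZeroPath-weaken (λ _ → ∣S∣<1⇒empty S ∣S∣<1 _)
          (switchedP₆ (proj₁ (proj₂ p₀)) (proj₂ (proj₂ p₀)) |p|≡6 n≡6 u v)
      where
      p₀ : Σ (List (Fin n)) λ p → Path T (λ _ → ⊤) u₀ v₀ p × Unique p
      p₀ = treePath u₀ v₀
      switched : Signing G
      switched = record { σ = switchAt u₀ σT ; σsym = switchAt-sym (Signing.σsym signing) u₀ }
    ... | no no-P₆ | _ = standardCanceling 5≤n λ u v |p|≡6 → ⊥-elim (no-P₆ (u , v , |p|≡6))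
    ... | yes _ | no n≢6 = standardCanceling 5≤n λ u v |p|≡6 →
      ℕ.≤∧≢⇒< (subst (_≤ n) |p|≡6 (Unique⇒length≤ (proj₂ (proj₂ (treePath u v))))) (n≢6 ∘ sym)

-- Squares of Hamiltonian cycles

CycAdj-sym : ∀ {k i j} → CycAdj k i j → CycAdj k j i
CycAdj-sym (inj₁ e)                = inj₂ (inj₁ e)
CycAdj-sym (inj₂ (inj₁ e))         = inj₁ e
CycAdj-sym (inj₂ (inj₂ (inj₁ e))) = inj₂ (inj₂ (inj₂ e))
CycAdj-sym (inj₂ (inj₂ (inj₂ e))) = inj₂ (inj₂ (inj₁ e))

CycAdj? : ∀ k i j → Dec (CycAdj k i j)
CycAdj? k i j = (suc (toℕ i) ℕ.≟ toℕ j) ⊎-dec (suc (toℕ j) ℕ.≟ toℕ i)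
  ⊎-dec (((toℕ i ℕ.≟ 0) ×-dec (suc (toℕ j) ℕ.≟ k)) ⊎-dec ((toℕ j ℕ.≟ 0) ×-dec (suc (toℕ i) ℕ.≟ k)))

cycleSign : ∀ {k} → Fin k → Fin k → Sign
cycleSign {k} i j = if does (CycAdj? k i j) then Sign.+ else Sign.-

cycleSign-sym : ∀ {k} (i j : Fin k) → cycleSign i j ≡ cycleSign j i
cycleSign-sym {k} i j = cong (if_then Sign.+ else Sign.-) (does-⇔ (mk⇔ CycAdj-sym CycAdj-sym) (CycAdj? k i j) (CycAdj? k j i))

module _ {m : ℕ} where

  nxt : Fin (suc m) → Fin (suc m)
  nxt x = suc (toℕ x) mod suc m

  toℕ-nxt : ∀ x → toℕ (nxt x) ≡ suc (toℕ x) % suc m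
  toℕ-nxt x = Fin.toℕ-fromℕ< _

  nxt⇒CycAdj : ∀ {x y} → nxt x ≡ y → CycAdj (suc m) x y
  nxt⇒CycAdj {x} {y} refl with ℕ.m≤n⇒m<n∨m≡n (Fin.toℕ<n x)
  ... | inj₁ x+1<n = inj₁ (sym (trans (toℕ-nxt x) (m<n⇒m%n≡m x+1<n)))
  ... | inj₂ x+1≡n = inj₂ (inj₂ (inj₂ (trans (toℕ-nxt x) (trans (cong (_% suc m) x+1≡n) (n%n≡0 (suc m))) , x+1≡n)))

  CycAdj⇒nxt : ∀ {x y} → CycAdj (suc m) x y → nxt x ≡ y ⊎ nxt y ≡ x
  CycAdj⇒nxt {x} {y} (inj₁ x+1≡y) =
    inj₁ (Fin.toℕ-injective (trans (toℕ-nxt x) (trans (m<n⇒m%n≡m (subst (_< suc m) (sym x+1≡y) (Fin.toℕ<n y))) x+1≡y)))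
  CycAdj⇒nxt {x} {y} (inj₂ (inj₁ y+1≡x)) =
    inj₂ (Fin.toℕ-injective (trans (toℕ-nxt y) (trans (m<n⇒m%n≡m (subst (_< suc m) (sym y+1≡x) (Fin.toℕ<n x))) y+1≡x)))
  CycAdj⇒nxt {x} {y} (inj₂ (inj₂ (inj₁ (x≡0 , y+1≡n)))) =
    inj₂ (Fin.toℕ-injective (trans (toℕ-nxt y) (trans (cong (_% suc m) y+1≡n) (trans (n%n≡0 (suc m)) (sym x≡0)))))
  CycAdj⇒nxt {x} {y} (inj₂ (inj₂ (inj₂ (y≡0 , x+1≡n)))) =
    inj₁ (Fin.toℕ-injective (trans (toℕ-nxt x) (trans (cong (_% suc m) x+1≡n) (trans (n%n≡0 (suc m)) (sym y≡0)))))

  nxt-injective : ∀ {x y} → nxt x ≡ nxt y → x ≡ y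
  nxt-injective {x} {y} e with ℕ.m≤n⇒m<n∨m≡n (Fin.toℕ<n x) | ℕ.m≤n⇒m<n∨m≡n (Fin.toℕ<n y)
  ... | inj₁ x+1<n | inj₁ y+1<n = Fin.toℕ-injective (ℕ.suc-injective
    (trans (sym (m<n⇒m%n≡m x+1<n)) (trans (sym (toℕ-nxt x)) (trans (cong toℕ e) (trans (toℕ-nxt y) (m<n⇒m%n≡m y+1<n))))))
  ... | inj₂ x+1≡n | inj₂ y+1≡n = Fin.toℕ-injective (ℕ.suc-injective (trans x+1≡n (sym y+1≡n)))
  ... | inj₁ x+1<n | inj₂ y+1≡n with
        trans (sym (m<n⇒m%n≡m x+1<n)) (trans (sym (toℕ-nxt x)) (trans (cong toℕ e)
          (trans (toℕ-nxt y) (trans (cong (_% suc m) y+1≡n) (n%n≡0 (suc m))))))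
  ...   | ()
  nxt-injective {x} {y} e | inj₂ x+1≡n | inj₁ y+1<n with
        trans (sym (m<n⇒m%n≡m y+1<n)) (trans (sym (toℕ-nxt y)) (trans (cong toℕ (sym e))
          (trans (toℕ-nxt x) (trans (cong (_% suc m) x+1≡n) (n%n≡0 (suc m))))))
  ...   | ()

  advance : Fin (suc m) → ℕ → Fin (suc m)
  advance s zero    = s
  advance s (suc i) = nxt (advance s i)

  advance-+ : ∀ s a b → advance (advance s a) b ≡ advance s (b + a)
  advance-+ s a zero    = refl
  advance-+ s a (suc b) = cong nxt (advance-+ s a b)

  advance-injectiveˡ : ∀ {x y} k → advance x k ≡ advance y k → x ≡ y
  advance-injectiveˡ zero    e = e
  advance-injectiveˡ (suc k) e = advance-injectiveˡ k (nxt-injective e)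

  toℕ-advance-zero : ∀ {i} → i < suc m → toℕ (advance Fin.zero i) ≡ i
  toℕ-advance-zero {zero}  _     = refl
  toℕ-advance-zero {suc i} i+1<n =
    trans (toℕ-nxt _) (trans (cong (λ t → suc t % suc m) (toℕ-advance-zero (ℕ.<-trans (ℕ.n<1+n i) i+1<n))) (m<n⇒m%n≡m i+1<n))

  advance-zero-toℕ : ∀ x → advance Fin.zero (toℕ x) ≡ x
  advance-zero-toℕ x = Fin.toℕ-injective (toℕ-advance-zero (Fin.toℕ<n x))

  advance-comm : ∀ x k → advance x k ≡ advance (advance Fin.zero k) (toℕ x)
  advance-comm x k = begin
    advance x k                                ≡⟨ cong (λ y → advance y k) (advance-zero-toℕ x) ⟨
    advance (advance Fin.zero (toℕ x)) k       ≡⟨ advance-+ Fin.zero (toℕ x) k ⟩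
    advance Fin.zero (k + toℕ x)               ≡⟨ cong (advance Fin.zero) (ℕ.+-comm k (toℕ x)) ⟩
    advance Fin.zero (toℕ x + k)               ≡⟨ advance-+ Fin.zero k (toℕ x) ⟨
    advance (advance Fin.zero k) (toℕ x)       ∎

  advance-aperiodic : ∀ {k} x → 0 < k → k < suc m → advance x k ≢ x
  advance-aperiodic {k} x 0<k k<n e = ℕ.<⇒≢ 0<k (sym (trans (sym (toℕ-advance-zero k<n)) (cong toℕ k-steps≡0)))
    where
    k-steps≡0 : advance Fin.zero k ≡ Fin.zero
    k-steps≡0 = advance-injectiveˡ (toℕ x) (trans (sym (advance-comm x k)) (trans e (sym (advance-zero-toℕ x))))

  advance-period : ∀ x → advance x (suc m) ≡ x
  advance-period x = trans (advance-comm x (suc m)) (trans (cong (λ y → advance y (toℕ x)) full-turn) (advance-zero-toℕ x))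
    where
    full-turn : advance Fin.zero (suc m) ≡ Fin.zero
    full-turn = Fin.toℕ-injective (trans (toℕ-nxt _)
      (trans (cong (λ t → suc t % suc m) (toℕ-advance-zero (ℕ.n<1+n m))) (n%n≡0 (suc m))))

  advance-injectiveʳ : ∀ s {i j} → i < suc m → j < suc m → advance s i ≡ advance s j → i ≡ j
  advance-injectiveʳ s {i} {j} i< j< e with ℕ.<-cmp i j
  ... | tri≈ _ i≡j _ = i≡j
  ... | tri< i<j _ _ = ⊥-elim (advance-aperiodic (advance s i) (ℕ.m<n⇒0<n∸m i<j) (ℕ.≤-<-trans (ℕ.m∸n≤m j i) j<)
                                (trans (advance-+ s i (j ∸ i)) (trans (cong (advance s) (ℕ.m∸n+n≡m (ℕ.<⇒≤ i<j))) (sym e))))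
  ... | tri> _ _ j<i = ⊥-elim (advance-aperiodic (advance s j) (ℕ.m<n⇒0<n∸m j<i) (ℕ.≤-<-trans (ℕ.m∸n≤m i j) i<)
                                (trans (advance-+ s j (i ∸ j)) (trans (cong (advance s) (ℕ.m∸n+n≡m (ℕ.<⇒≤ j<i))) e)))

  NearSquare : Fin (suc m) → Fin (suc m) → Set
  NearSquare x y = x ≢ y × (nxt x ≡ y ⊎ nxt y ≡ x ⊎ nxt (nxt x) ≡ y ⊎ nxt (nxt y) ≡ x)

  nearSquare? : ∀ x y → Dec (NearSquare x y)
  nearSquare? x y = ¬? (x Fin.≟ y)
    ×-dec (nxt x Fin.≟ y ⊎-dec nxt y Fin.≟ x ⊎-dec nxt (nxt x) Fin.≟ y ⊎-dec nxt (nxt y) Fin.≟ x)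

  NearSquare⇒SqRel : ∀ {x y} → NearSquare x y → SqRel (CycAdj (suc m)) x y
  NearSquare⇒SqRel (x≢y , inj₁ e)                = x≢y , inj₁ (nxt⇒CycAdj e)
  NearSquare⇒SqRel (x≢y , inj₂ (inj₁ e))         = x≢y , inj₁ (CycAdj-sym (nxt⇒CycAdj e))
  NearSquare⇒SqRel (x≢y , inj₂ (inj₂ (inj₁ e))) = x≢y , inj₂ (_ , nxt⇒CycAdj refl , nxt⇒CycAdj e)
  NearSquare⇒SqRel (x≢y , inj₂ (inj₂ (inj₂ e))) = x≢y , inj₂ (_ , CycAdj-sym (nxt⇒CycAdj e) , CycAdj-sym (nxt⇒CycAdj refl))

  squareEdge : (Fin (suc m) → Fin (suc m) → Sign) → ℕ → ℕ → Maybe Sign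
  squareEdge τ i j with nearSquare? (advance Fin.zero i) (advance Fin.zero j)
  ... | yes _ = just (τ (advance Fin.zero i) (advance Fin.zero j))
  ... | no  _ = nothing

  squareEdge⇒SqRel : ∀ {τ i j s} → squareEdge τ i j ≡ just s →
                     SqRel (CycAdj (suc m)) (advance Fin.zero i) (advance Fin.zero j) × τ (advance Fin.zero i) (advance Fin.zero j) ≡ s
  squareEdge⇒SqRel {τ} {i} {j} ij with nearSquare? (advance Fin.zero i) (advance Fin.zero j)
  squareEdge⇒SqRel refl | yes near = NearSquare⇒SqRel near , refl
  squareEdge⇒SqRel ()   | no  _

  -- The square of the cycle on the positions 0 … m (position i is advance 0 i), with position c removed.
  cycleSquare : (Fin (suc m) → Fin (suc m) → Sign) → ℕ → Model
  cycleSquare τ c = record { size = suc m ; edge = squareEdge τ ; removed = λ i → does (i ℕ.≟ c) }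

injective⇒surjective : ∀ {n} (f : Fin n → Fin n) → (∀ {i j} → f i ≡ f j → i ≡ j) → ∀ y → Σ (Fin n) λ x → f x ≡ y
injective⇒surjective {n} f f-inj y with Fin.any? {n = n} (λ x → f x Fin.≟ y)
... | yes found = found
injective⇒surjective {suc n} f f-inj y | no missed =
  ⊥-elim (ℕ.<-irrefl refl (Fin.injective⇒≤ {f = squeeze} λ e → f-inj (Fin.punchOut-injective (avoids _) (avoids _) e)))
  where
  avoids : ∀ x → y ≢ f x
  avoids x e = missed (x , sym e)
  squeeze : Fin (suc n) → Fin n
  squeeze x = Fin.punchOut (avoids x)

module HamiltonianSquare {m : ℕ} (G : Graph (suc m)) (f : Fin (suc m) → Fin (suc m))
                         (f-injective : ∀ {i j} → f i ≡ f j → i ≡ j)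
                         (f-square : ∀ i j → SqRel (CycAdj (suc m)) i j → Adj G (f i) (f j)) where

  position : Fin (suc m) → Fin (suc m)
  position u = proj₁ (injective⇒surjective f f-injective u)

  f-position : ∀ u → f (position u) ≡ u
  f-position u = proj₂ (injective⇒surjective f f-injective u)

  position-f : ∀ x → position (f x) ≡ x
  position-f x = f-injective (f-position (f x))

  module Positional (τ : Fin (suc m) → Fin (suc m) → Sign) (τ-sym : ∀ x y → τ x y ≡ τ y x) where

    signing : Signing G
    signing = record { σ = λ u v → τ (position u) (position v) ; σsym = λ u v → τ-sym (position u) (position v) }

    σ′ : Fin (suc m) → Fin (suc m) → Sign
    σ′ = Signing.σ signing

    square-signed : ∀ {x y s} → SqRel (CycAdj (suc m)) x y → τ x y ≡ s → Adj G (f x) (f y) × σ′ (f x) (f y) ≡ s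
    square-signed {x} {y} sq τ≡s = f-square x y sq , trans (cong₂ τ (position-f x) (position-f y)) τ≡s

    cycleSquare-embedding : ∀ w → Embedding (cycleSquare τ (toℕ (position w))) G (_≢ w) σ′
    cycleSquare-embedding w = record
      { vertex    = f ∘ advance Fin.zero
      ; injective = λ i< j< → advance-injectiveʳ Fin.zero i< j< ∘ f-injective
      ; edge⇒adj  = λ _ _ ij → let (sq , τ≡s) = squareEdge⇒SqRel ij in square-signed sq τ≡s
      ; allowed   = allowed
      }
      where
      allowed : ∀ {i} → Kept (cycleSquare τ _) i → f (advance Fin.zero i) ≢ w
      allowed {i} (i< , i-kept) e with trans (sym (dec-true (i ℕ.≟ _) i≡c)) i-kept
        where
        i≡c : i ≡ toℕ (position w)
        i≡c = trans (sym (toℕ-advance-zero i<)) (cong toℕ (trans (sym (position-f _)) (cong position e)))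
      ... | ()

    on-cycle : ∀ u → f (advance Fin.zero (toℕ (position u))) ≡ u
    on-cycle u = trans (cong f (advance-zero-toℕ _)) (f-position u)

    avoiding-by-search : Bool.T (all (allPairsRoutable ∘ cycleSquare τ) (upTo (suc m))) →
                         ∀ w u v → u ≢ w → v ≢ w → ZeroPath G (_≢ w) σ′ u v
    avoiding-by-search routable w u v u≢w v≢w =
      subst₂ (ZeroPath G (_≢ w) σ′) (on-cycle u) (on-cycle v)
        (Embedding.zeroPath (cycleSquare-embedding w)
          (routable⇒ZeroRoute _ (all-upTo (allPairsRoutable ∘ cycleSquare τ) routable (Fin.toℕ<n (position w)))
            (kept u≢w) (kept v≢w)))
      where
      kept : ∀ {x} → x ≢ w → Kept (cycleSquare τ (toℕ (position w))) (toℕ (position x))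
      kept {x} x≢w = Fin.toℕ<n _ , dec-false (_ ℕ.≟ _) λ e →
        x≢w (trans (sym (f-position x)) (trans (cong f (Fin.toℕ-injective e)) (f-position w)))

  module _ (7≤m : 7 ≤ m) where
    open Positional cycleSign cycleSign-sym

    private
      small<n : ∀ {k} → k ≤ 7 → k < suc m
      small<n k≤7 = s≤s (ℕ.≤-trans k≤7 7≤m)

      1<n : 1 < suc m
      1<n = small<n (s≤s z≤n)

      cycle-edge : ∀ x → Adj G (f x) (f (nxt x)) × σ′ (f x) (f (nxt x)) ≡ Sign.+
      cycle-edge x = square-signed (x≢nxt , inj₁ x~nxt) (cong (if_then Sign.+ else Sign.-) (dec-true (CycAdj? _ _ _) x~nxt))
        where
        x~nxt : CycAdj (suc m) x (nxt x)
        x~nxt = nxt⇒CycAdj refl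
        x≢nxt : x ≢ nxt x
        x≢nxt = advance-aperiodic x (s≤s z≤n) 1<n ∘ sym

      chord : ∀ x → Adj G (f x) (f (nxt (nxt x))) × σ′ (f x) (f (nxt (nxt x))) ≡ Sign.-
      chord x = square-signed (x≢nxt² , inj₂ (nxt x , nxt⇒CycAdj refl , nxt⇒CycAdj refl))
                  (cong (if_then Sign.+ else Sign.-) (dec-false (CycAdj? _ _ _) not-adjacent))
        where
        x≢nxt² : x ≢ nxt (nxt x)
        x≢nxt² = advance-aperiodic x (s≤s z≤n) (small<n (s≤s (s≤s z≤n))) ∘ sym
        not-adjacent : ¬ CycAdj (suc m) x (nxt (nxt x))
        not-adjacent x~nxt² with CycAdj⇒nxt x~nxt²
        ... | inj₁ e = advance-aperiodic x (s≤s z≤n) 1<n (sym (nxt-injective e))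
        ... | inj₂ e = advance-aperiodic x (s≤s z≤n) (small<n (s≤s (s≤s (s≤s z≤n)))) e

      flip : ∀ {u v s} → Adj G u v × σ′ u v ≡ s → Adj G v u × σ′ v u ≡ s
      flip {u} {v} (uv , σ≡s) = Adj-sym {G = G} uv , trans (Signing.σsym signing v u) σ≡s

    -- The cycle with w removed is a path on m vertices, starting right after w.
    ladder-embedding : ∀ w → Embedding (ladder m) G (_≢ w) σ′
    ladder-embedding w = record
      { vertex    = f ∘ advance (nxt c)
      ; injective = λ i< j< → advance-injectiveʳ _ (ℕ.m<n⇒m<1+n i<) (ℕ.m<n⇒m<1+n j<) ∘ f-injective
      ; edge⇒adj  = λ {i} {j} _ _ e → signed (ladderEdge⇒step {i} {j} e)
      ; allowed   = allowed
      }
      where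
      c : Fin (suc m)
      c = position w
      signed : ∀ {i j s} → LadderStep i j s →
               Adj G (f (advance (nxt c) i)) (f (advance (nxt c) j)) × σ′ (f (advance (nxt c) i)) (f (advance (nxt c) j)) ≡ s
      signed forward₁  = cycle-edge _
      signed forward₂  = chord _
      signed backward₁ = flip (cycle-edge _)
      signed backward₂ = flip (chord _)
      allowed : ∀ {i} → Kept (ladder m) i → f (advance (nxt c) i) ≢ w
      allowed {i} (i< , _) e = advance-aperiodic c (ℕ.m≤n+m 1 i) (subst (_< suc m) (ℕ.+-comm 1 i) (s≤s i<))
        (trans (sym (advance-+ c 1 i)) (trans (sym (position-f _)) (cong position e)))

    ladder-position : ∀ w u → u ≢ w → Σ ℕ λ a → a < m × f (advance (nxt (position w)) a) ≡ u
    ladder-position w u u≢w with onto (position u)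
      where
      onto : ∀ x → Σ (Fin (suc m)) λ a → advance (nxt (position w)) (toℕ a) ≡ x
      onto = injective⇒surjective (advance (nxt (position w)) ∘ toℕ)
               (Fin.toℕ-injective ∘ advance-injectiveʳ _ (Fin.toℕ<n _) (Fin.toℕ<n _))
    ... | a , a↦u with ℕ.m≤n⇒m<n∨m≡n (ℕ.≤-pred (Fin.toℕ<n a))
    ...   | inj₁ a<m = toℕ a , a<m , trans (cong f a↦u) (f-position u)
    ...   | inj₂ a≡m = ⊥-elim (u≢w (u≡w))
      where
      u≡w : u ≡ w
      u≡w = trans (sym (f-position u)) (trans (cong f (trans (sym a↦u) last)) (f-position w))
        where
        last : advance (nxt (position w)) (toℕ a) ≡ position w
        last = trans (cong (advance _) a≡m)
                 (trans (advance-+ (position w) 1 m) (trans (cong (advance (position w)) (ℕ.+-comm m 1)) (advance-period (position w))))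

    avoiding-on-ladder : ∀ w u v → u ≢ w → v ≢ w → ZeroPath G (_≢ w) σ′ u v
    avoiding-on-ladder w u v u≢w v≢w
      with a , a<m , a↦u ← ladder-position w u u≢w
      with b , b<m , b↦v ← ladder-position w v v≢w
      with ℕ.<-cmp a b
    ... | tri< a<b _ _ = subst₂ (ZeroPath G (_≢ w) σ′) a↦u b↦v
                           (Embedding.zeroPath (ladder-embedding w) (ladder-zeroRoute 7≤m a<b b<m))
    ... | tri≈ _ refl _ = subst (ZeroPath G (_≢ w) σ′ u) (trans (sym a↦u) b↦v) (ZeroPath-refl u≢w)
    ... | tri> _ _ b<a = ZeroPath-sym signing (subst₂ (ZeroPath G (_≢ w) σ′) b↦v a↦u
                           (Embedding.zeroPath (ladder-embedding w) (ladder-zeroRoute 7≤m b<a a<m)))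

  -- Avoiding a single vertex suffices: with no vertex deleted, avoid any third vertex.
  kCanceling₂ : (s : Signing G) → 2 < suc m →
                (∀ w u v → u ≢ w → v ≢ w → ZeroPath G (_≢ w) (Signing.σ s) u v) → KCanceling 2 G
  kCanceling₂ s 2<n avoiding = s , λ S ∣S∣<2 → Wσ≡0 G S s (pairs S ∣S∣<2)
    where
    pairs : ∀ S → ∣ S ∣ < 2 → ∀ u v → Outside G S u → Outside G S v → ZeroPath G (Outside G S) (Signing.σ s) u v
    pairs S ∣S∣<2 u v u∉S v∉S with ∣S∣<2⇒empty⊎singleton S ∣S∣<2
    ... | inj₁ empty with w , w∉uv ← missing (u ∷ v ∷ []) 2<n =
      ZeroPath-weaken (λ {x} _ → empty x) (avoiding w u v (λ { refl → w∉uv (here refl) }) λ { refl → w∉uv (there (here refl)) })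
    ... | inj₂ (w , w∈S , only) =
      ZeroPath-weaken (λ {x} → only x) (avoiding w u v (outside u∉S) (outside v∉S))
      where
      outside : ∀ {x} → Outside G S x → x ≢ w
      outside x∉S refl with trans (sym w∈S) x∉S
      ... | ()

-- cycleSign is not 2-canceling on the square of C₇; this signing, negative exactly on the six listed pairs, was found
-- by computer search.
sevenNegative : ℕ → ℕ → Bool.Bool
sevenNegative a b = ((a ≡ᵇ 1) Bool.∧ (b ≡ᵇ 6)) ∨ ((a ≡ᵇ 2) Bool.∧ ((b ≡ᵇ 3) ∨ (b ≡ᵇ 4)))
                  ∨ ((a ≡ᵇ 3) Bool.∧ ((b ≡ᵇ 4) ∨ (b ≡ᵇ 5))) ∨ ((a ≡ᵇ 4) Bool.∧ (b ≡ᵇ 5))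

sevenSign : Fin 7 → Fin 7 → Sign
sevenSign x y = if sevenNegative (toℕ x) (toℕ y) ∨ sevenNegative (toℕ y) (toℕ x) then Sign.- else Sign.+

sevenSign-sym : ∀ x y → sevenSign x y ≡ sevenSign y x
sevenSign-sym x y = cong (if_then Sign.- else Sign.+) (Bool.∨-comm (sevenNegative (toℕ x) (toℕ y)) (sevenNegative (toℕ y) (toℕ x)))

hamiltonian-2-canceling : ∀ n → 5 ≤ n → (G : Graph n) → ContainsSqHamCycle G → KCanceling 2 G
hamiltonian-2-canceling 5 _ G (f , f-inj , f-sq) =
  kCanceling₂ signing (s≤s (s≤s (s≤s z≤n))) (avoiding-by-search _)
  where open HamiltonianSquare G f f-inj f-sq; open Positional cycleSign cycleSign-sym
hamiltonian-2-canceling 6 _ G (f , f-inj , f-sq) =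
  kCanceling₂ signing (s≤s (s≤s (s≤s z≤n))) (avoiding-by-search _)
  where open HamiltonianSquare G f f-inj f-sq; open Positional cycleSign cycleSign-sym
hamiltonian-2-canceling 7 _ G (f , f-inj , f-sq) =
  kCanceling₂ signing (s≤s (s≤s (s≤s z≤n))) (avoiding-by-search _)
  where open HamiltonianSquare G f f-inj f-sq; open Positional sevenSign sevenSign-sym
hamiltonian-2-canceling (suc m@(suc (suc (suc (suc (suc (suc (suc _)))))))) _ G (f , f-inj , f-sq) =
  kCanceling₂ signing (s≤s (s≤s (s≤s z≤n))) (avoiding-on-ladder (s≤s (s≤s (s≤s (s≤s (s≤s (s≤s (s≤s z≤n))))))))
  where open HamiltonianSquare G f f-inj f-sq; open Positional cycleSign cycleSign-sym
hamiltonian-2-canceling 1 (s≤s ()) _ _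
hamiltonian-2-canceling 2 (s≤s (s≤s ())) _ _
hamiltonian-2-canceling 3 (s≤s (s≤s (s≤s ()))) _ _
hamiltonian-2-canceling 4 (s≤s (s≤s (s≤s (s≤s ())))) _ _

theorem1p3 : (n : ℕ) → 5 ≤ n → (G : Graph n) →
    (ContainsSqTree G → Canceling G) × (ContainsSqHamCycle G → KCanceling 2 G)
theorem1p3 n 5≤n G =
  (λ { (T , (connected , acyclic) , T²⊆G) → TreeSquare.canceling T G acyclic T²⊆G connected 5≤n }) ,
  hamiltonian-2-canceling n 5≤n G
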